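{- The theta graph $\theta_{2,2,4}$ is not an $i$-graph, i.e. there is no graph $G$ with $\mathcal{I}(G)\cong\theta_{2,2,4}$.
   Context: For a graph $G$, an $i$-set is an independent dominating set of minimum cardinality. The $i$-graph $\mathcal{I}(G)$ has the $i$-sets as vertices, with $X\sim Y$ iff $Y=(X\setminus\{u\})\cup\{v\}$ for some $u\in X$, $v\notin X$ with $uv\in E(G)$. $\theta_{j,k,\ell}$ denotes two vertices joined by three internally vertex-disjoint paths of lengths $j,k,\ell$. -}

module Defs where

open import Data.Nat using (ℕ; _≤_)
open import Data.Fin using (Fin; zero; suc)
open import Data.Fin.Subset using (Subset; _∈_; _∉_; _-_; _∪_; ⁅_⁆; ∣_∣)
open import Data.Product using (Σ; ∃; ∃-syntax; _×_; _,_)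
open import Data.Sum using (_⊎_)
open import Data.Empty using (⊥)
open import Relation.Nullary using (¬_)
open import Relation.Binary using (Decidable)
open import Relation.Binary.PropositionalEquality using (_≡_)
open import Function.Bundles using (_⇔_)

record Graph (n : ℕ) : Set₁ where
  field
    Adj     : Fin n → Fin n → Set
    adj?    : Decidable Adj
    sym     : ∀ {u v} → Adj u v → Adj v u
    irrefl  : ∀ {u} → ¬ Adj u u

module _ {n : ℕ} (G : Graph n) where
  open Graph G

  Independent : Subset n → Set
  Independent S = ∀ u v → u ∈ S → v ∈ S → ¬ Adj u v

  Dominating : Subset n → Set
  Dominating S = ∀ v → v ∈ S ⊎ (∃[ u ] (u ∈ S × Adj u v))

  IndepDom : Subset n → Set
  IndepDom S = Independent S × Dominating S

  IsISet : Subset n → Set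
  IsISet S = IndepDom S × (∀ T → IndepDom T → ∣ S ∣ ≤ ∣ T ∣)

  IAdj : Subset n → Subset n → Set
  IAdj X Y = ∃[ u ] ∃[ v ] (u ∈ X × v ∉ X × Adj u v × Y ≡ (X - u) ∪ ⁅ v ⁆)

-- θ_{2,2,4}: vertices 0,1 are the two branch vertices; paths
-- 0-2-1, 0-3-1, 0-4-5-6-1.
data ThetaEdge : Fin 7 → Fin 7 → Set where
  e02 : ThetaEdge zero (suc (suc zero))
  e21 : ThetaEdge (suc (suc zero)) (suc zero)
  e03 : ThetaEdge zero (suc (suc (suc zero)))
  e31 : ThetaEdge (suc (suc (suc zero))) (suc zero)
  e04 : ThetaEdge zero (suc (suc (suc (suc zero))))
  e45 : ThetaEdge (suc (suc (suc (suc zero)))) (suc (suc (suc (suc (suc zero)))))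
  e56 : ThetaEdge (suc (suc (suc (suc (suc zero))))) (suc (suc (suc (suc (suc (suc zero))))))
  e61 : ThetaEdge (suc (suc (suc (suc (suc (suc zero)))))) (suc zero)

Theta224Adj : Fin 7 → Fin 7 → Set
Theta224Adj a b = ThetaEdge a b ⊎ ThetaEdge b a

IGraphIsoTheta224 : {n : ℕ} → Graph n → Set
IGraphIsoTheta224 {n} G =
  Σ (Fin 7 → Subset n) λ f →
    (∀ a → IsISet G (f a)) ×
    (∀ a b → f a ≡ f b → a ≡ b) ×
    (∀ X → IsISet G X → ∃[ a ] (f a ≡ X)) ×
    (∀ a b → Theta224Adj a b ⇔ IAdj G (f a) (f b))

{-# OPTIONS --safe #-}
-- Let A, B be the i-sets at the branch vertices, Cᵢ (i = 2, 3) the middle vertices of the two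
-- short paths, with A → Cᵢ exchanging uᵢ for vᵢ, and A, C₄, C₅, C₆, B the long path.
-- As θ₂,₂,₄ has no triangles and A, B are at distance two, the exchange Cᵢ → B neither removes
-- vᵢ nor brings back uᵢ; hence B contains v₂, v₃ but not u₂, u₃, where u₂ ≠ u₃ and v₂ ≠ v₃.
-- The three exchanges of the long path must then remove both uᵢ and add both vᵢ, which forces
-- the middle one, C₄ → C₅, to exchange some uᵢ for some vⱼ.  If i = j this makes C₅ adjacent
-- to Cᵢ; if i ≠ j the adjacent vertices uᵢ and vⱼ both lie in the independent set Cⱼ.
module Submission where

open import Defs
open import Data.Nat using (ℕ)
open import Data.Fin using (Fin; _≟_; #_)
open import Data.Fin.Subset using (Subset; _∈_; _∉_; _─_; _-_; _∪_; ⁅_⁆; inside; outside)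
open import Data.Fin.Subset.Properties
  using (x∈p∪q⁻; x∈p∪q⁺; x∈⁅x⁆; x∈⁅y⁆⇒x≡y; x∈p∧x≢y⇒x∈p-y; p─q⊆p; ⊆-antisym)
open import Data.Vec using (_∷_; here; there)
open import Data.Product using (_×_; _,_; proj₁; proj₂)
open import Data.Sum using (_⊎_; inj₁; inj₂)
open import Data.Empty using (⊥; ⊥-elim)
open import Function using (_∘_)
open import Function.Bundles using (_⇔_; Equivalence)
open import Relation.Nullary using (¬_; yes; no)
open import Relation.Binary.PropositionalEquality
  using (_≡_; _≢_; refl; sym; trans; subst; subst₂)

x∈p─q⇒x∉q : ∀ {n} {p q : Subset n} {x} → x ∈ p ─ q → x ∉ q
x∈p─q⇒x∉q {p = inside ∷ _} {outside ∷ _} here ()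
x∈p─q⇒x∉q {p = _ ∷ _} {_ ∷ _} (there x∈p─q) (there x∈q) = x∈p─q⇒x∉q x∈p─q x∈q

x∈p-y⇒x≢y : ∀ {n} {p : Subset n} {x y} → x ∈ p - y → x ≢ y
x∈p-y⇒x≢y x∈p-x refl = x∈p─q⇒x∉q x∈p-x (x∈⁅x⁆ _)

x∈p∧y∉p⇒x≢y : ∀ {n} {p : Subset n} {x y} → x ∈ p → y ∉ p → x ≢ y
x∈p∧y∉p⇒x≢y x∈p x∉p refl = x∉p x∈p

record Swap {n} (X Y : Subset n) (u v : Fin n) : Set where
  field
    removed∈ : u ∈ X
    added∉   : v ∉ X
    result   : Y ≡ (X - u) ∪ ⁅ v ⁆

open Swap public

module _ {n} {X Y : Subset n} {u v : Fin n} (s : Swap X Y u v) where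

  ∈-swap⁻ : ∀ {w} → w ∈ Y → (w ∈ X × w ≢ u) ⊎ w ≡ v
  ∈-swap⁻ {w} w∈Y with x∈p∪q⁻ (X - u) ⁅ v ⁆ (subst (w ∈_) (result s) w∈Y)
  ... | inj₁ w∈X-u = inj₁ (p─q⊆p X ⁅ u ⁆ w∈X-u , x∈p-y⇒x≢y w∈X-u)
  ... | inj₂ w∈⁅v⁆ = inj₂ (x∈⁅y⁆⇒x≡y v w∈⁅v⁆)

  ∈-swap⁺ : ∀ {w} → w ∈ X → w ≢ u → w ∈ Y
  ∈-swap⁺ w∈X w≢u = subst (_ ∈_) (sym (result s)) (x∈p∪q⁺ (inj₁ (x∈p∧x≢y⇒x∈p-y w∈X w≢u)))

  added∈ : v ∈ Y
  added∈ = subst (v ∈_) (sym (result s)) (x∈p∪q⁺ (inj₂ (x∈⁅x⁆ v)))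

  removed∉ : u ∉ Y
  removed∉ u∈Y with ∈-swap⁻ u∈Y
  ... | inj₁ (_ , u≢u) = u≢u refl
  ... | inj₂ u≡v = x∈p∧y∉p⇒x≢y (removed∈ s) (added∉ s) u≡v

∈-swap²⁻ : ∀ {n} {X Y Z : Subset n} {u v p q w} → Swap X Y u v → Swap Y Z p q →
           w ∈ Z → (w ∈ X ⊎ w ≡ v) ⊎ w ≡ q
∈-swap²⁻ s t w∈Z with ∈-swap⁻ t w∈Z
... | inj₂ w≡q = inj₂ w≡q
... | inj₁ (w∈Y , _) with ∈-swap⁻ s w∈Y
...   | inj₁ (w∈X , _) = inj₁ (inj₁ w∈X)
...   | inj₂ w≡v = inj₁ (inj₂ w≡v)

swap-from-∈ : ∀ {n} {X Y : Subset n} {u v} → u ∈ X → v ∉ X → v ∈ Y →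
              (∀ {w} → w ∈ X → w ≢ u → w ∈ Y) →
              (∀ {w} → w ∈ Y → (w ∈ X × w ≢ u) ⊎ w ≡ v) → Swap X Y u v
swap-from-∈ {X = X} {Y} {u} {v} u∈X v∉X v∈Y keep gain = record
  { removed∈ = u∈X ; added∉ = v∉X ; result = ⊆-antisym Y⊆ ⊆Y }
  where
  Y⊆ : ∀ {w} → w ∈ Y → w ∈ (X - u) ∪ ⁅ v ⁆
  Y⊆ w∈Y with gain w∈Y
  ... | inj₁ (w∈X , w≢u) = x∈p∪q⁺ (inj₁ (x∈p∧x≢y⇒x∈p-y w∈X w≢u))
  ... | inj₂ refl = x∈p∪q⁺ (inj₂ (x∈⁅x⁆ v))
  ⊆Y : ∀ {w} → w ∈ (X - u) ∪ ⁅ v ⁆ → w ∈ Y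
  ⊆Y w∈ with x∈p∪q⁻ (X - u) ⁅ v ⁆ w∈
  ... | inj₁ w∈X-u = keep (p─q⊆p X ⁅ u ⁆ w∈X-u) (x∈p-y⇒x≢y w∈X-u)
  ... | inj₂ w∈⁅v⁆ = subst (_∈ Y) (sym (x∈⁅y⁆⇒x≡y v w∈⁅v⁆)) v∈Y

swap-unique : ∀ {n} {X Y Z : Subset n} {u v} → Swap X Y u v → Swap X Z u v → Y ≡ Z
swap-unique s t = trans (result s) (sym (result t))

swap-sym : ∀ {n} {X Y : Subset n} {u v} → Swap X Y u v → Swap Y X v u
swap-sym {X = X} {Y} {u} {v} s =
  swap-from-∈ (added∈ s) (removed∉ s) (removed∈ s) keep gain
  where
  keep : ∀ {w} → w ∈ Y → w ≢ v → w ∈ X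
  keep w∈Y w≢v with ∈-swap⁻ s w∈Y
  ... | inj₁ (w∈X , _) = w∈X
  ... | inj₂ w≡v = ⊥-elim (w≢v w≡v)
  gain : ∀ {w} → w ∈ X → (w ∈ Y × w ≢ v) ⊎ w ≡ u
  gain {w} w∈X with w ≟ u
  ... | yes w≡u = inj₂ w≡u
  ... | no w≢u = inj₁ (∈-swap⁺ s w∈X w≢u , x∈p∧y∉p⇒x≢y w∈X (added∉ s))

swap-cancel : ∀ {n} {X Y Z : Subset n} {u v q} → Swap X Y u v → Swap Y Z v q → q ≢ u →
              Swap X Z u q
swap-cancel {X = X} {Z = Z} {u} {v} {q} s t q≢u =
  swap-from-∈ (removed∈ s) q∉X (added∈ t) keep gain
  where
  q∉X : q ∉ X
  q∉X q∈X = added∉ t (∈-swap⁺ s q∈X q≢u)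
  keep : ∀ {w} → w ∈ X → w ≢ u → w ∈ Z
  keep w∈X w≢u = ∈-swap⁺ t (∈-swap⁺ s w∈X w≢u) (x∈p∧y∉p⇒x≢y w∈X (added∉ s))
  gain : ∀ {w} → w ∈ Z → (w ∈ X × w ≢ u) ⊎ w ≡ q
  gain w∈Z with ∈-swap⁻ t w∈Z
  ... | inj₂ w≡q = inj₂ w≡q
  ... | inj₁ (w∈Y , w≢v) with ∈-swap⁻ s w∈Y
  ...   | inj₁ w∈X∧w≢u = inj₁ w∈X∧w≢u
  ...   | inj₂ w≡v = ⊥-elim (w≢v w≡v)

swaps-commute : ∀ {n} {A C D E : Subset n} {u v a b} →
                Swap A C u v → Swap A D a b → Swap D E u v → a ≢ u → b ≢ v → Swap C E a b
swaps-commute {A = A} {C} {D} {E} {u} {v} {a} {b} sAC sAD sDE a≢u b≢v =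
  swap-from-∈ (∈-swap⁺ sAC (removed∈ sAD) a≢u) b∉C b∈E keep gain
  where
  b∉C : b ∉ C
  b∉C b∈C with ∈-swap⁻ sAC b∈C
  ... | inj₁ (b∈A , _) = added∉ sAD b∈A
  ... | inj₂ b≡v = b≢v b≡v
  b∈E : b ∈ E
  b∈E = ∈-swap⁺ sDE (added∈ sAD) (x∈p∧y∉p⇒x≢y (removed∈ sAC) (added∉ sAD) ∘ sym)
  keep : ∀ {w} → w ∈ C → w ≢ a → w ∈ E
  keep w∈C w≢a with ∈-swap⁻ sAC w∈C
  ... | inj₁ (w∈A , w≢u) = ∈-swap⁺ sDE (∈-swap⁺ sAD w∈A w≢a) w≢u
  ... | inj₂ refl = added∈ sDE
  gain : ∀ {w} → w ∈ E → (w ∈ C × w ≢ a) ⊎ w ≡ b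
  gain w∈E with ∈-swap⁻ sDE w∈E
  ... | inj₂ refl = inj₁ (added∈ sAC , x∈p∧y∉p⇒x≢y (removed∈ sAD) (added∉ sAC) ∘ sym)
  ... | inj₁ (w∈D , w≢u) with ∈-swap⁻ sAD w∈D
  ...   | inj₁ (w∈A , w≢a) = inj₁ (∈-swap⁺ sAC w∈A w≢u , w≢a)
  ...   | inj₂ w≡b = inj₂ w≡b

module _ {n : ℕ} (G : Graph n) where
  open Graph G using (Adj) renaming (sym to Adj-sym)

  Apart : Subset n → Subset n → Set
  Apart X Y = ¬ (X ≡ Y ⊎ IAdj G X Y)

  record Step (X Y : Subset n) : Set where
    field
      {old new} : Fin n
      swap      : Swap X Y old new
      adj       : Adj old new

  IAdj⇒Step : ∀ {X Y} → IAdj G X Y → Step X Y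
  IAdj⇒Step (_ , _ , u∈X , v∉X , u~v , Y≡) =
    record { swap = record { removed∈ = u∈X ; added∉ = v∉X ; result = Y≡ } ; adj = u~v }

  swap⇒IAdj : ∀ {X Y u v} → Swap X Y u v → Adj u v → IAdj G X Y
  swap⇒IAdj {u = u} {v} s u~v = u , v , removed∈ s , added∉ s , u~v , result s

  -- v is dominated in X, and only u ∈ X can do so without breaking the independence of Y.
  swap⇒Adj : ∀ {X Y u v} → Swap X Y u v → Dominating G X → Independent G Y → Adj u v
  swap⇒Adj {u = u} {v} s domX indY with domX v
  ... | inj₁ v∈X = ⊥-elim (added∉ s v∈X)
  ... | inj₂ (c , c∈X , c~v) with c ≟ u
  ...   | yes c≡u = subst (λ x → Adj x v) c≡u c~v
  ...   | no c≢u = ⊥-elim (indY c v (∈-swap⁺ s c∈X c≢u) (added∈ s) c~v)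

  apart⇒removed≢ : ∀ {X Y Z u v u′ w} → Swap X Y u v → Swap X Z u′ w →
                   Independent G Y → Dominating G Z → Apart Y Z → u ≢ u′
  apart⇒removed≢ {Y = Y} {Z} {v = v} {w = w} s t indY domZ apart refl with v ≟ w
  ... | yes refl = apart (inj₁ (swap-unique s t))
  ... | no v≢w = apart (inj₂ (swap⇒IAdj sYZ (Adj-sym (swap⇒Adj (swap-sym sYZ) domZ indY))))
    where
    sYZ : Swap Y Z v w
    sYZ = swap-cancel (swap-sym s) t (v≢w ∘ sym)

  apart⇒¬removes-added : ∀ {X Y Z u v g h} → Swap X Y u v → Swap Y Z g h →
                         Dominating G X → Independent G Z → Apart X Z → g ≢ v
  apart⇒¬removes-added {X} {Z = Z} {u} {h = h} s t domX indZ apart refl with h ≟ u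
  ... | yes refl = apart (inj₁ (swap-unique (swap-sym s) t))
  ... | no h≢u = apart (inj₂ (swap⇒IAdj sXZ (swap⇒Adj sXZ domX indZ)))
    where
    sXZ : Swap X Z u h
    sXZ = swap-cancel s t h≢u

  ¬removes-added⇒¬readds-removed : ∀ {X Y Z u v g h} → Swap X Y u v → Swap Y Z g h →
                                   Adj g h → Independent G X → g ≢ v → h ≢ u
  ¬removes-added⇒¬readds-removed s t g~h indX g≢v refl with ∈-swap⁻ s (removed∈ t)
  ... | inj₁ (g∈X , _) = indX _ _ g∈X (removed∈ s) g~h
  ... | inj₂ g≡v = g≢v g≡v

module Realisation {n : ℕ} (G : Graph n) (f : Fin 7 → Subset n)
  (isI : ∀ c → IsISet G (f c))
  (inj : ∀ c d → f c ≡ f d → c ≡ d)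
  (iso : ∀ c d → Theta224Adj c d ⇔ IAdj G (f c) (f d))
  where
  open Graph G using (Adj)

  independent : ∀ c → Independent G (f c)
  independent c = proj₁ (proj₁ (isI c))

  dominating : ∀ c → Dominating G (f c)
  dominating c = proj₂ (proj₁ (isI c))

  apart : ∀ c d → ¬ ThetaEdge c d → ¬ ThetaEdge d c → c ≢ d → Apart G (f c) (f d)
  apart c d ¬c→d ¬d→c c≢d (inj₁ fc≡fd) = c≢d (inj c d fc≡fd)
  apart c d ¬c→d ¬d→c c≢d (inj₂ fc~fd) with Equivalence.from (iso c d) fc~fd
  ... | inj₁ c→d = ¬c→d c→d
  ... | inj₂ d→c = ¬d→c d→c

  step : ∀ {c d} → ThetaEdge c d → Step G (f c) (f d)
  step e = IAdj⇒Step G (Equivalence.to (iso _ _) (inj₁ e))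

  A B C₄ C₅ C₆ : Subset n
  A = f (# 0)
  B = f (# 1)
  C₄ = f (# 4)
  C₅ = f (# 5)
  C₆ = f (# 6)

  open Step (step e04) using () renaming (old to a; new to b; swap to s04; adj to a~b)
  open Step (step e45) using () renaming (old to p; new to q; swap to s45; adj to p~q)
  open Step (step e56) using () renaming (old to r; new to s; swap to s56)
  open Step (step e61) using () renaming (old to k; new to l; swap to s61; adj to k~l)

  module ShortPath {c : Fin 7} (e0c : ThetaEdge (# 0) c) (ec1 : ThetaEdge c (# 1))
    (apart-4c : Apart G C₄ (f c)) (apart-c5 : Apart G (f c) C₅) (apart-6c : Apart G C₆ (f c))
    where
    open Step (step e0c) public using () renaming (old to u; new to v; swap to s0c; adj to u~v)
    open Step (step ec1) using () renaming (old to g; new to h; swap to sc1; adj to g~h)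

    ¬Adj-added : ∀ {w} → w ∈ A → w ≢ u → ¬ Adj w v
    ¬Adj-added w∈A w≢u = independent c _ _ (∈-swap⁺ s0c w∈A w≢u) (added∈ s0c)

    a≢u : a ≢ u
    a≢u = apart⇒removed≢ G s04 s0c (independent (# 4)) (dominating c) apart-4c

    l≢h : l ≢ h
    l≢h = apart⇒removed≢ G (swap-sym s61) (swap-sym sc1) (independent (# 6)) (dominating c) apart-6c

    b≢v : b ≢ v
    b≢v b≡v = ¬Adj-added (removed∈ s04) a≢u (subst (Adj a) b≡v a~b)

    g≢v : g ≢ v
    g≢v = apart⇒¬removes-added G s0c sc1 (dominating (# 0)) (independent (# 1))
            (apart (# 0) (# 1) (λ ()) (λ ()) (λ ()))

    v∈B : v ∈ B
    v∈B = ∈-swap⁺ sc1 (added∈ s0c) (g≢v ∘ sym)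

    u∉B : u ∉ B
    u∉B u∈B with ∈-swap⁻ sc1 u∈B
    ... | inj₁ (u∈C , _) = removed∉ s0c u∈C
    ... | inj₂ u≡h = ¬removes-added⇒¬readds-removed G s0c sc1 g~h (independent (# 0)) g≢v (sym u≡h)

    l∈A⊎l≡v : l ∈ A ⊎ l ≡ v
    l∈A⊎l≡v with ∈-swap²⁻ s0c sc1 (added∈ s61)
    ... | inj₁ l∈A⊎l≡v = l∈A⊎l≡v
    ... | inj₂ l≡h = ⊥-elim (l≢h l≡h)

    v∈C₅⇒v≡q : v ∈ C₅ → v ≡ q
    v∈C₅⇒v≡q v∈C₅ with ∈-swap²⁻ s04 s45 v∈C₅
    ... | inj₁ (inj₁ v∈A) = ⊥-elim (added∉ s0c v∈A)
    ... | inj₁ (inj₂ v≡b) = ⊥-elim (b≢v (sym v≡b))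
    ... | inj₂ v≡q = v≡q

    ¬[p≡u∧q≡v] : p ≡ u → q ≡ v → ⊥
    ¬[p≡u∧q≡v] p≡u q≡v = apart-c5 (inj₂ (swap⇒IAdj G (swaps-commute s0c s04 s45′ a≢u b≢v) a~b))
      where
      s45′ : Swap C₄ C₅ u v
      s45′ = subst₂ (Swap C₄ C₅) p≡u q≡v s45

    ¬[p≡w∧q≡v] : ∀ {w} → w ∈ A → w ≢ u → p ≡ w → q ≡ v → ⊥
    ¬[p≡w∧q≡v] w∈A w≢u p≡w q≡v = ¬Adj-added w∈A w≢u (subst₂ Adj p≡w q≡v p~q)

    module _ (l∈A : l ∈ A) where

      k≢u : k ≢ u
      k≢u k≡u = independent (# 0) u l (removed∈ s0c) l∈A (subst (λ x → Adj x l) k≡u k~l)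

      u≡p⊎u≡r : u ≡ p ⊎ u ≡ r
      u≡p⊎u≡r with u ≟ p | u ≟ r
      ... | yes u≡p | _ = inj₁ u≡p
      ... | no _ | yes u≡r = inj₂ u≡r
      ... | no u≢p | no u≢r = ⊥-elim (u∉B u∈B)
        where
        u∈B : u ∈ B
        u∈B = ∈-swap⁺ s61 (∈-swap⁺ s56 (∈-swap⁺ s45
                (∈-swap⁺ s04 (removed∈ s0c) (a≢u ∘ sym)) u≢p) u≢r) (k≢u ∘ sym)

      v∈C₅⊎v≡s : v ∈ C₅ ⊎ v ≡ s
      v∈C₅⊎v≡s with ∈-swap²⁻ s56 s61 v∈B
      ... | inj₁ v∈C₅⊎v≡s = v∈C₅⊎v≡s
      ... | inj₂ v≡l = ⊥-elim (added∉ s0c (subst (_∈ A) (sym v≡l) l∈A))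

  module P₂ = ShortPath e02 e21
    (apart (# 4) (# 2) (λ ()) (λ ()) (λ ()))
    (apart (# 2) (# 5) (λ ()) (λ ()) (λ ()))
    (apart (# 6) (# 2) (λ ()) (λ ()) (λ ()))
  module P₃ = ShortPath e03 e31
    (apart (# 4) (# 3) (λ ()) (λ ()) (λ ()))
    (apart (# 3) (# 5) (λ ()) (λ ()) (λ ()))
    (apart (# 6) (# 3) (λ ()) (λ ()) (λ ()))

  u₂≢u₃ : P₂.u ≢ P₃.u
  u₂≢u₃ = apart⇒removed≢ G P₂.s0c P₃.s0c (independent (# 2)) (dominating (# 3))
            (apart (# 2) (# 3) (λ ()) (λ ()) (λ ()))

  v₂≢v₃ : P₂.v ≢ P₃.v
  v₂≢v₃ v₂≡v₃ = P₂.¬Adj-added (removed∈ P₃.s0c) (u₂≢u₃ ∘ sym) (subst (Adj P₃.u) (sym v₂≡v₃) P₃.u~v)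

  l∈A : l ∈ A
  l∈A with P₂.l∈A⊎l≡v | P₃.l∈A⊎l≡v
  ... | inj₁ l∈A | _ = l∈A
  ... | inj₂ _ | inj₁ l∈A = l∈A
  ... | inj₂ l≡v₂ | inj₂ l≡v₃ = ⊥-elim (v₂≢v₃ (trans (sym l≡v₂) l≡v₃))

  p≡u₂⊎p≡u₃ : p ≡ P₂.u ⊎ p ≡ P₃.u
  p≡u₂⊎p≡u₃ with P₂.u≡p⊎u≡r l∈A | P₃.u≡p⊎u≡r l∈A
  ... | inj₁ u₂≡p | _ = inj₁ (sym u₂≡p)
  ... | inj₂ _ | inj₁ u₃≡p = inj₂ (sym u₃≡p)
  ... | inj₂ u₂≡r | inj₂ u₃≡r = ⊥-elim (u₂≢u₃ (trans u₂≡r (sym u₃≡r)))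

  q≡v₂⊎q≡v₃ : q ≡ P₂.v ⊎ q ≡ P₃.v
  q≡v₂⊎q≡v₃ with P₂.v∈C₅⊎v≡s l∈A | P₃.v∈C₅⊎v≡s l∈A
  ... | inj₁ v₂∈C₅ | _ = inj₁ (sym (P₂.v∈C₅⇒v≡q v₂∈C₅))
  ... | inj₂ _ | inj₁ v₃∈C₅ = inj₂ (sym (P₃.v∈C₅⇒v≡q v₃∈C₅))
  ... | inj₂ v₂≡s | inj₂ v₃≡s = ⊥-elim (v₂≢v₃ (trans v₂≡s (sym v₃≡s)))

  impossible : ⊥
  impossible with p≡u₂⊎p≡u₃ | q≡v₂⊎q≡v₃
  ... | inj₁ p≡u₂ | inj₁ q≡v₂ = P₂.¬[p≡u∧q≡v] p≡u₂ q≡v₂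
  ... | inj₂ p≡u₃ | inj₂ q≡v₃ = P₃.¬[p≡u∧q≡v] p≡u₃ q≡v₃
  ... | inj₁ p≡u₂ | inj₂ q≡v₃ = P₃.¬[p≡w∧q≡v] (removed∈ P₂.s0c) u₂≢u₃ p≡u₂ q≡v₃
  ... | inj₂ p≡u₃ | inj₁ q≡v₂ = P₂.¬[p≡w∧q≡v] (removed∈ P₃.s0c) (u₂≢u₃ ∘ sym) p≡u₃ q≡v₂

mainTheorem6 : (n : ℕ) (G : Graph n) → ¬ IGraphIsoTheta224 G
mainTheorem6 n G (f , isI , inj , _ , iso) = Realisation.impossible G f isI inj iso
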